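{- Let $G$ be a connected bipartite graph with partition classes $A$ and $B$, and let $v$ be a vertex in $B$. If all vertices in $A$ have even degree, then there exists a balanced forest $F\subseteq G$, all of whose leaves lie in $B$, such that in $G-E(F)$ all vertices in $B\setminus \{v\}$ have odd degree.
   Context: All graphs are finite and simple. A forest is balanced if it has a bipartition such that all vertices in one of the partition classes have even degree. -}

module Defs where

open import Data.Nat using (ℕ; zero; suc; _+_; _≤_)
open import Data.Nat.Divisibility using (_∣_)
open import Data.Fin using (Fin)
open import Data.Bool using (Bool; true; false; if_then_else_; _∧_; not)
open import Data.List using (List; []; _∷_; _++_; [_]; length; map; allFin)
open import Data.Nat.ListAction using (sum)
open import Data.List.Relation.Unary.Linked using (Linked)
open import Data.List.Relation.Unary.Unique.Propositional using (Unique)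
open import Data.Product using (Σ; _×_; ∃)
open import Relation.Binary.PropositionalEquality using (_≡_; _≢_)
open import Relation.Nullary using (¬_)
open import Data.Empty using (⊥)

record Graph (n : ℕ) : Set where
  field
    adj    : Fin n → Fin n → Bool
    adj-sym : ∀ u w → adj u w ≡ adj w u
    adj-irr : ∀ u → adj u u ≡ false
open Graph public

Adj : ∀ {n} → Graph n → Fin n → Fin n → Set
Adj G u w = adj G u w ≡ true

degOf : ∀ {n} → (Fin n → Fin n → Bool) → Fin n → ℕ
degOf {n} a v = sum (map (λ w → if a v w then 1 else 0) (allFin n))

deg : ∀ {n} → Graph n → Fin n → ℕ
deg G = degOf (adj G)

Even : ℕ → Set
Even m = 2 ∣ m

data Walk {n} (G : Graph n) : Fin n → Fin n → Set where
  here : ∀ {u} → Walk G u u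
  step : ∀ {u w x} → Adj G u w → Walk G w x → Walk G u x

Connected : ∀ {n} → Graph n → Set
Connected G = ∀ u w → Walk G u w

IsCycle : ∀ {n} → Graph n → List (Fin n) → Set
IsCycle G [] = ⊥
IsCycle G (x ∷ xs) = 2 ≤ length xs × Unique (x ∷ xs) × Linked (Adj G) (x ∷ xs ++ [ x ])

IsForest : ∀ {n} → Graph n → Set
IsForest G = ∀ c → ¬ IsCycle G c

IsBipartition : ∀ {n} → Graph n → (Fin n → Bool) → Set
IsBipartition G side = ∀ u w → Adj G u w → side u ≢ side w

Balanced : ∀ {n} → Graph n → Set
Balanced G = Σ (Fin _ → Bool) λ c → IsBipartition G c × Σ Bool λ b → ∀ x → c x ≡ b → Even (deg G x)

-- F ⊆ G (as edge sets; F spanning, isolated vertices irrelevant)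
_⊆G_ : ∀ {n} → Graph n → Graph n → Set
F ⊆G G = ∀ u w → Adj F u w → Adj G u w

minusE : ∀ {n} → Graph n → Graph n → Fin n → Fin n → Bool
minusE G F u w = adj G u w ∧ not (adj F u w)

-- Take a breadth-first spanning tree rooted at v. Working from the leaves towards v, keep the edge
-- from each vertex x ≠ v to its parent exactly when this gives deg_F x the parity required at x:
-- even on A, and on B the parity opposite to deg_G x, so that x has odd degree in G - E(F).
-- F is a subforest of the tree and is balanced for the bipartition (A , B); a leaf has odd degree,
-- so it is v or lies in B.
module Submission where

open import Defs
open import Data.Bool using (Bool; true; false; if_then_else_; _∧_; _∨_; not)
open import Data.Bool.Properties using (∨-comm) renaming (_≟_ to _≟ᵇ_)
open import Data.Empty using (⊥)
open import Data.Fin using (Fin; zero; suc; punchIn)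
open import Data.Fin.Properties using (_≟_; any?; punchInᵢ≢i)
open import Data.List using (List; []; _∷_; _++_; tabulate)
open import Data.List.Membership.Propositional using (_∈_; _∉_)
open import Data.List.Membership.Propositional.Properties using (∈-++⁺ʳ)
open import Data.List.Properties using (map-tabulate)
open import Data.List.Relation.Unary.All using (All; _∷_)
import Data.List.Relation.Unary.All as All
open import Data.List.Relation.Unary.AllPairs using (_∷_)
open import Data.List.Relation.Unary.Any using (here)
open import Data.List.Relation.Unary.Linked using (Linked; [-]; _∷_)
import Data.List.Relation.Unary.Linked as Linked
open import Data.List.Relation.Unary.Linked.Properties using (Linked⇒AllPairs)
open import Data.List.Relation.Unary.Unique.Propositional using (Unique)
open import Data.Nat using (ℕ; zero; suc; _+_; _≤_; _<_; z≤n; s≤s; parity)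
open import Data.Nat.Divisibility using (divides)
open import Data.Nat.ListAction using (sum)
open import Data.Nat.Properties
  using (+-0-commutativeMonoid; +-identityʳ; +-suc; +-monoʳ-≤; m≤m+n; m<m+n; n<1+n; ≮⇒≥; <⇒≱;
         m<1+n⇒m<n∨m≡n; <-irrefl; <-trans; <-≤-trans; ≤-<-trans)
open import Data.Parity using (Parity; 0ℙ; 1ℙ; _⁻¹) renaming (_+_ to _⊕_)
import Data.Parity.Properties as ℙ
open import Data.Product using (Σ; ∃; _×_; _,_; proj₁; proj₂)
open import Data.Sum using (_⊎_; inj₁; inj₂; [_,_])
open import Data.Unit.Polymorphic using (⊤; tt)
open import Data.Vec.Functional using (removeAt; replicate)
open import Function using (flip)
open import Relation.Binary using (Rel; Transitive; Irreflexive)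
open import Relation.Binary.PropositionalEquality
  using (_≡_; _≢_; refl; sym; trans; cong; cong₂; subst; module ≡-Reasoning)
open import Relation.Nullary using (¬_; Dec; yes; no; does; contradiction)
open import Relation.Nullary.Decidable using (_×-dec_; _⊎-dec_)
open import Relation.Unary using (Pred; Decidable)
open import Algebra.Properties.CommutativeMonoid.Sum +-0-commutativeMonoid
  using (sum-cong-≗; sum-remove; ∑-distrib-+; sum-replicate-zero) renaming (sum to ∑)

even⇒parity≡0ℙ : ∀ {m} → Even m → parity m ≡ 0ℙ
even⇒parity≡0ℙ (divides q refl) = trans (ℙ.*-homo-* q 2) (ℙ.*-zeroʳ (parity q))

parity≡0ℙ⇒even : ∀ m → parity m ≡ 0ℙ → Even m
parity≡0ℙ⇒even zero _ = divides 0 refl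
parity≡0ℙ⇒even (suc (suc m)) p with parity≡0ℙ⇒even m p
... | divides q refl = divides (suc q) refl

isOdd : Parity → Bool
isOdd 0ℙ = false
isOdd 1ℙ = true

indicator : Bool → ℕ
indicator b = if b then 1 else 0

parity-indicator-isOdd : ∀ p → parity (indicator (isOdd p)) ≡ p
parity-indicator-isOdd 0ℙ = refl
parity-indicator-isOdd 1ℙ = refl

indicator-∨ : ∀ a b → (a ≡ true → b ≡ true → ⊥) → indicator (a ∨ b) ≡ indicator a + indicator b
indicator-∨ true true disjoint = contradiction refl (disjoint refl)
indicator-∨ true false _ = refl
indicator-∨ false b _ = refl

sum-tabulate : ∀ {n} (f : Fin n → ℕ) → sum (tabulate f) ≡ ∑ f
sum-tabulate {zero} f = refl
sum-tabulate {suc n} f = cong (f zero +_) (sum-tabulate (λ i → f (suc i)))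

∑-term≤ : ∀ {n} (f : Fin n → ℕ) i → f i ≤ ∑ f
∑-term≤ {suc n} f i rewrite sum-remove {i = i} f = m≤m+n (f i) _

∑-concentrated : ∀ {n} (f : Fin n → ℕ) p → (∀ w → w ≢ p → f w ≡ 0) → ∑ f ≡ f p
∑-concentrated {suc n} f p f≡0 = begin
  ∑ f                     ≡⟨ sum-remove f ⟩
  f p + ∑ (removeAt f p)  ≡⟨ cong (f p +_) (sum-cong-≗ (λ j → f≡0 (punchIn p j) (punchInᵢ≢i p j))) ⟩
  f p + ∑ (replicate n 0) ≡⟨ cong (f p +_) (sum-replicate-zero n) ⟩
  f p + 0                 ≡⟨ +-identityʳ _ ⟩
  f p                     ∎
  where open ≡-Reasoning

degOf≡∑ : ∀ {n} (a : Fin n → Fin n → Bool) x → degOf a x ≡ ∑ (λ w → indicator (a x w))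
degOf≡∑ {n} a x = trans (cong sum (map-tabulate {n = n} (λ w → w) (λ w → indicator (a x w))))
                        (sum-tabulate {n} (λ w → indicator (a x w)))

degOf-minusE : ∀ {n} (G F : Graph n) → F ⊆G G → ∀ x → degOf (minusE G F) x + deg F x ≡ deg G x
degOf-minusE {n} G F F⊆G x = begin
  degOf (minusE G F) x + deg F x
    ≡⟨ cong₂ _+_ (degOf≡∑ (minusE G F) x) (degOf≡∑ (adj F) x) ⟩
  ∑ (λ w → indicator (adj G x w ∧ not (adj F x w))) + ∑ (λ w → indicator (adj F x w))
    ≡⟨ ∑-distrib-+ {n} _ _ ⟨
  ∑ (λ w → indicator (adj G x w ∧ not (adj F x w)) + indicator (adj F x w))
    ≡⟨ sum-cong-≗ (λ w → split (adj G x w) (adj F x w) (F⊆G x w)) ⟩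
  ∑ (λ w → indicator (adj G x w))
    ≡⟨ degOf≡∑ (adj G) x ⟨
  deg G x ∎
  where
  open ≡-Reasoning
  split : ∀ g f → (f ≡ true → g ≡ true) → indicator (g ∧ not f) + indicator f ≡ indicator g
  split true true _ = refl
  split true false _ = refl
  split false true f⇒g = contradiction (f⇒g refl) λ ()
  split false false _ = refl

Minimal : ∀ {p} → Pred ℕ p → ℕ → Set p
Minimal P m = P m × ∀ {j} → P j → m ≤ j

module _ {p} {P : Pred ℕ p} (P? : Decidable P) where

  private
    searchBelow : ∀ b → (∀ {j} → j < b → ¬ P j) ⊎ ∃ (Minimal P)
    searchBelow zero = inj₁ λ ()
    searchBelow (suc b) with searchBelow b
    ... | inj₂ m = inj₂ m
    ... | inj₁ none with P? b
    ...   | yes pb = inj₂ (b , pb , λ pj → ≮⇒≥ λ j<b → none j<b pj)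
    ...   | no ¬pb = inj₁ λ j<1+b pj →
            [ (λ j<b → none j<b pj) , (λ { refl → ¬pb pj }) ] (m<1+n⇒m<n∨m≡n j<1+b)

  minimalWitness : ∀ {k} → P k → ∃ (Minimal P)
  minimalWitness {k} pk with searchBelow (suc k)
  ... | inj₂ m = m
  ... | inj₁ none = contradiction pk (none (n<1+n k))

record SpanningTree {n} (G : Graph n) (root : Fin n) : Set where
  field
    parent : Fin n → Fin n
    depth : Fin n → ℕ
    parent-adjacent : ∀ {x} → x ≢ root → Adj G x (parent x)
    parent-depth : ∀ {x} → x ≢ root → depth (parent x) < depth x

module BreadthFirst {n} (G : Graph n) (root : Fin n) where

  ReachesWithin : ℕ → Fin n → Set
  ReachesWithin zero x = x ≡ root
  ReachesWithin (suc k) x = ReachesWithin k x ⊎ ∃ λ w → Adj G x w × ReachesWithin k w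

  reachesWithin? : ∀ k → Decidable (ReachesWithin k)
  reachesWithin? zero x = x ≟ root
  reachesWithin? (suc k) x =
    reachesWithin? k x ⊎-dec any? λ w → (adj G x w ≟ᵇ true) ×-dec reachesWithin? k w

  length : ∀ {x y} → Walk G x y → ℕ
  length here = 0
  length (step _ p) = suc (length p)

  walk⇒reachesWithin : ∀ {x} (p : Walk G x root) → ReachesWithin (length p) x
  walk⇒reachesWithin here = refl
  walk⇒reachesWithin (step x~w p) = inj₂ (_ , x~w , walk⇒reachesWithin p)

  module _ (connected : Connected G) where

    minimalDepth : ∀ x → ∃ λ d → Minimal (λ k → ReachesWithin k x) d
    minimalDepth x = minimalWitness (λ k → reachesWithin? k x) (walk⇒reachesWithin (connected x root))

    depth : Fin n → ℕ
    depth x = proj₁ (minimalDepth x)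

    stepTowardsRoot : ∀ {x} → x ≢ root → ∃ λ w → Adj G x w × depth w < depth x
    stepTowardsRoot {x} x≢r with minimalDepth x
    ... | zero , x≡r , _ = contradiction x≡r x≢r
    ... | suc k , inj₁ reach , minimal = contradiction (minimal reach) (<-irrefl refl)
    ... | suc k , inj₂ (w , x~w , reach) , _ = w , x~w , s≤s (proj₂ (proj₂ (minimalDepth w)) reach)

    parent : Fin n → Fin n
    parent x with x ≟ root
    ... | yes _ = root
    ... | no x≢r = proj₁ (stepTowardsRoot x≢r)

    parent-step : ∀ {x} → x ≢ root → Adj G x (parent x) × depth (parent x) < depth x
    parent-step {x} x≢r with x ≟ root
    ... | yes x≡r = contradiction x≡r x≢r
    ... | no x≢r′ = proj₂ (stepTowardsRoot x≢r′)

    spanningTree : SpanningTree G root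
    spanningTree = record
      { parent = parent ; depth = depth
      ; parent-adjacent = λ x≢r → proj₁ (parent-step x≢r)
      ; parent-depth = λ x≢r → proj₂ (parent-step x≢r) }

module _ {a} {A : Set a} where

  NonBacktracking : List A → Set a
  NonBacktracking (x ∷ xs@(_ ∷ z ∷ _)) = x ≢ z × NonBacktracking xs
  NonBacktracking _ = ⊤

  LastLink : ∀ {ℓ} → Rel A ℓ → A → A → List A → Set ℓ
  LastLink R x y [] = R x y
  LastLink R x y (z ∷ zs) = LastLink R y z zs

  lastLink-∷ʳ : ∀ {ℓ} {R : Rel A ℓ} {x y} u v zs → LastLink R u v (zs ++ x ∷ y ∷ []) → R x y
  lastLink-∷ʳ u v [] Rxy = Rxy
  lastLink-∷ʳ u v (z ∷ zs) = lastLink-∷ʳ v z zs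

  closedWalk-nonBacktracking : ∀ {x y} u v zs → Unique (u ∷ v ∷ zs) → All (_≢ x) (u ∷ v ∷ zs) →
    All (_≢ y) (v ∷ zs) → NonBacktracking (u ∷ v ∷ zs ++ x ∷ y ∷ [])
  closedWalk-nonBacktracking u v [] _ (u≢x ∷ _) (v≢y ∷ _) = u≢x , v≢y , tt
  closedWalk-nonBacktracking u v (w ∷ zs) ((_ ∷ u≢w ∷ _) ∷ unique) (_ ∷ ≢x) (_ ∷ ≢y) =
    u≢w , closedWalk-nonBacktracking v w zs unique ≢x ≢y

  cycle-nonBacktracking : ∀ x y z zs → Unique (x ∷ y ∷ z ∷ zs) →
    NonBacktracking (x ∷ y ∷ (z ∷ zs) ++ x ∷ y ∷ [])
  cycle-nonBacktracking x y z zs ((x≢y ∷ x≢z ∷ x≢zs) ∷ unique@((y≢z ∷ y≢zs) ∷ _)) =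
    x≢z , closedWalk-nonBacktracking y z zs unique
            (All.map (λ x≢ ≡x → x≢ (sym ≡x)) (x≢y ∷ x≢z ∷ x≢zs))
            (All.map (λ y≢ ≡y → y≢ (sym ≡y)) (y≢z ∷ y≢zs))

  Linked-∷ʳ : ∀ {ℓ} {R : Rel A ℓ} {x y} zs →
    Linked R (zs ++ x ∷ []) → R x y → Linked R (zs ++ x ∷ y ∷ [])
  Linked-∷ʳ [] _ Rxy = Rxy ∷ [-]
  Linked-∷ʳ (z ∷ []) (Rzx ∷ _) Rxy = Rzx ∷ Rxy ∷ [-]
  Linked-∷ʳ (z ∷ w ∷ zs) (Rzw ∷ rest) Rxy = Rzw ∷ Linked-∷ʳ (w ∷ zs) rest Rxy

  Linked⇒∉ : ∀ {ℓ} {R : Rel A ℓ} → Transitive R → Irreflexive _≡_ R →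
    ∀ {x xs} → Linked R (x ∷ xs) → x ∉ xs
  Linked⇒∉ trans irrefl linked x∈xs with Linked⇒AllPairs trans linked
  ... | Rx ∷ _ = irrefl refl (All.lookup Rx x∈xs)

module ParentPointers {n} (root : Fin n) (parent : Fin n → Fin n) (rank : Fin n → ℕ)
  (parent-rank : ∀ {x} → x ≢ root → rank (parent x) < rank x) where

  _ParentOf_ : Rel (Fin n) _
  p ParentOf x = x ≢ root × parent x ≡ p

  parentOf-rank : ∀ {p x} → p ParentOf x → rank p < rank x
  parentOf-rank (x≢r , refl) = parent-rank x≢r

  parentOf-unique : ∀ {p q x} → p ParentOf x → q ParentOf x → p ≡ q
  parentOf-unique (_ , refl) (_ , refl) = refl

  TreeEdge : Rel (Fin n) _
  TreeEdge u w = u ParentOf w ⊎ w ParentOf u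

  descending-persists : ∀ {x y} zs → Linked TreeEdge (x ∷ y ∷ zs) → NonBacktracking (x ∷ y ∷ zs) →
    x ParentOf y → Linked _ParentOf_ (x ∷ y ∷ zs)
  descending-persists [] _ _ x⇝y = x⇝y ∷ [-]
  descending-persists (z ∷ zs) (_ ∷ edges@(inj₁ y⇝z ∷ _)) (_ , nb) x⇝y =
    x⇝y ∷ descending-persists zs edges nb y⇝z
  descending-persists (z ∷ zs) (_ ∷ inj₂ z⇝y ∷ _) (x≢z , _) x⇝y =
    contradiction (parentOf-unique x⇝y z⇝y) x≢z

  ascending-or-endsDescending : ∀ {x y} zs → Linked TreeEdge (x ∷ y ∷ zs) → NonBacktracking (x ∷ y ∷ zs) →
    Linked (flip _ParentOf_) (x ∷ y ∷ zs) ⊎ LastLink _ParentOf_ x y zs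
  ascending-or-endsDescending [] (inj₁ x⇝y ∷ _) _ = inj₂ x⇝y
  ascending-or-endsDescending [] (inj₂ y⇝x ∷ _) _ = inj₁ (y⇝x ∷ [-])
  ascending-or-endsDescending (z ∷ zs) (xy ∷ edges) (x≢z , nb) with ascending-or-endsDescending zs edges nb
  ... | inj₂ last = inj₂ last
  ... | inj₁ ascending@(z⇝y ∷ _) with xy
  ...   | inj₂ y⇝x = inj₁ (y⇝x ∷ ascending)
  ...   | inj₁ x⇝y = contradiction (parentOf-unique x⇝y z⇝y) x≢z

  ascending-noReturn : ∀ {x xs} → Linked (flip _ParentOf_) (x ∷ xs) → x ∉ xs
  ascending-noReturn ascending =
    Linked⇒∉ {R = λ u w → rank w < rank u} (flip <-trans) (λ { refl → <-irrefl refl })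
      (Linked.map parentOf-rank ascending)

  descending-noReturn : ∀ {x xs} → Linked _ParentOf_ (x ∷ xs) → x ∉ xs
  descending-noReturn descending =
    Linked⇒∉ {R = λ u w → rank u < rank w} <-trans (λ { refl → <-irrefl refl })
      (Linked.map parentOf-rank descending)

  -- Go once around the cycle and repeat its first edge. Without backtracking, a walk along tree edges
  -- never steps up again after stepping down, so the walk is either ascending throughout or descends
  -- from its (repeated) first edge on; either way the rank forbids returning to the start.
  treeEdges⇒forest : (F : Graph n) → (∀ {u w} → Adj F u w → TreeEdge u w) → IsForest F
  treeEdges⇒forest F tree [] ()
  treeEdges⇒forest F tree (x ∷ []) (() , _)
  treeEdges⇒forest F tree (x ∷ y ∷ []) (s≤s () , _)
  treeEdges⇒forest F tree (x ∷ y ∷ z ∷ zs) (_ , unique , cycle@(x~y ∷ _)) =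
    [ (λ ascending → ascending-noReturn ascending returns)
    , (λ last → descending-noReturn
                  (descending-persists _ walk nonBacktracking (lastLink-∷ʳ y z zs last)) returns)
    ] (ascending-or-endsDescending _ walk nonBacktracking)
    where
    walk : Linked TreeEdge (x ∷ y ∷ (z ∷ zs) ++ x ∷ y ∷ [])
    walk = Linked.map tree (Linked-∷ʳ (x ∷ y ∷ z ∷ zs) cycle x~y)
    nonBacktracking = cycle-nonBacktracking x y z zs unique
    returns : x ∈ y ∷ (z ∷ zs) ++ x ∷ y ∷ []
    returns = ∈-++⁺ʳ (y ∷ z ∷ zs) (here refl)

  _parentOf?_ : ∀ p x → Dec (p ParentOf x)
  p parentOf? x with x ≟ root | parent x ≟ p
  ... | yes x≡r | _ = no λ (x≢r , _) → x≢r x≡r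
  ... | no x≢r | yes refl = yes (x≢r , refl)
  ... | no _ | no ≢p = no λ (_ , ≡p) → ≢p ≡p

  module ParitySubforest (target : Fin n → Parity) where

    -- chosen x says whether the edge from x to its parent is kept. The parity target at x determines
    -- it from the choices at the children of x, so it is computed from the leaves up, by recursion on
    -- fuel; the fuel is irrelevant once it exceeds every rank.
    chosenChildren : (Fin n → Bool) → Fin n → ℕ
    chosenChildren chosen x = ∑ λ w → indicator (does (x parentOf? w) ∧ chosen w)

    chosenChildren-cong : ∀ {f g} x → (∀ {w} → x ParentOf w → f w ≡ g w) →
      chosenChildren f x ≡ chosenChildren g x
    chosenChildren-cong {f} {g} x f≗g = sum-cong-≗ pointwise
      where
      pointwise : ∀ w → indicator (does (x parentOf? w) ∧ f w) ≡ indicator (does (x parentOf? w) ∧ g w)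
      pointwise w with x parentOf? w
      ... | yes x⇝w = cong indicator (f≗g x⇝w)
      ... | no _ = refl

    chosenWithin : ℕ → Fin n → Bool
    chosenWithin zero _ = false
    chosenWithin (suc k) x = isOdd (target x ⊕ parity (chosenChildren (chosenWithin k) x))

    rankBound : ℕ
    rankBound = ∑ rank

    chosenWithin-stable : ∀ j k {x} → rankBound < j + rank x → rankBound < k + rank x →
      chosenWithin j x ≡ chosenWithin k x
    chosenWithin-stable zero _ {x} j-enough _ = contradiction (∑-term≤ rank x) (<⇒≱ j-enough)
    chosenWithin-stable (suc _) zero {x} _ k-enough = contradiction (∑-term≤ rank x) (<⇒≱ k-enough)
    chosenWithin-stable (suc j) (suc k) {x} j-enough k-enough =
      cong (λ c → isOdd (target x ⊕ parity c)) (chosenChildren-cong x λ x⇝w →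
        chosenWithin-stable j k (towardsLeaves j j-enough x⇝w) (towardsLeaves k k-enough x⇝w))
      where
      towardsLeaves : ∀ i {w} → rankBound < suc i + rank x → x ParentOf w → rankBound < i + rank w
      towardsLeaves i {w} enough x⇝w =
        <-≤-trans enough (subst (_≤ i + rank w) (+-suc i (rank x)) (+-monoʳ-≤ i (parentOf-rank x⇝w)))

    chosen : Fin n → Bool
    chosen = chosenWithin (suc rankBound)

    chosen-parity : ∀ x → parity (indicator (chosen x)) ≡ target x ⊕ parity (chosenChildren chosen x)
    chosen-parity x = trans (parity-indicator-isOdd _) (cong (λ c → target x ⊕ parity c)
      (chosenChildren-cong x λ x⇝w → chosenWithin-stable rankBound (suc rankBound)
        (m<m+n rankBound (≤-<-trans z≤n (parentOf-rank x⇝w))) (m≤m+n (suc rankBound) _)))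

    selected : Fin n → Fin n → Bool
    selected u w = does (w parentOf? u) ∧ chosen u

    selected⇒parentOf : ∀ {u w} → selected u w ≡ true → w ParentOf u
    selected⇒parentOf {u} {w} s with w parentOf? u
    ... | yes w⇝u = w⇝u

    selected-irrefl : ∀ u → selected u u ≡ false
    selected-irrefl u with u parentOf? u
    ... | yes u⇝u = contradiction (parentOf-rank u⇝u) (<-irrefl refl)
    ... | no _ = refl

    selected-asym : ∀ {u w} → selected u w ≡ true → selected w u ≡ true → ⊥
    selected-asym su sw =
      <-irrefl refl (<-trans (parentOf-rank (selected⇒parentOf su)) (parentOf-rank (selected⇒parentOf sw)))

    subforest : Graph n
    subforest = record
      { adj = λ u w → selected u w ∨ selected w u
      ; adj-sym = λ u w → ∨-comm (selected u w) (selected w u)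
      ; adj-irr = λ u → cong₂ _∨_ (selected-irrefl u) (selected-irrefl u) }

    subforest-treeEdge : ∀ {u w} → Adj subforest u w → TreeEdge u w
    subforest-treeEdge {u} {w} u~w with selected u w in su
    ... | true = inj₂ (selected⇒parentOf su)
    ... | false = inj₁ (selected⇒parentOf u~w)

    selected-toParent : ∀ {x} → x ≢ root → selected x (parent x) ≡ chosen x
    selected-toParent {x} x≢r with parent x parentOf? x
    ... | yes _ = refl
    ... | no ¬p⇝x = contradiction (x≢r , refl) ¬p⇝x

    selected-notToParent : ∀ {x w} → w ≢ parent x → selected x w ≡ false
    selected-notToParent {x} {w} w≢p with w parentOf? x
    ... | yes (_ , p≡w) = contradiction (sym p≡w) w≢p
    ... | no _ = refl

    deg-subforest : ∀ {x} → x ≢ root → deg subforest x ≡ indicator (chosen x) + chosenChildren chosen x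
    deg-subforest {x} x≢r = begin
      deg subforest x
        ≡⟨ degOf≡∑ (adj subforest) x ⟩
      ∑ (λ w → indicator (selected x w ∨ selected w x))
        ≡⟨ sum-cong-≗ (λ w → indicator-∨ (selected x w) (selected w x) selected-asym) ⟩
      ∑ (λ w → indicator (selected x w) + indicator (selected w x))
        ≡⟨ ∑-distrib-+ {n} _ _ ⟩
      ∑ (λ w → indicator (selected x w)) + chosenChildren chosen x
        ≡⟨ cong (_+ chosenChildren chosen x)
             (∑-concentrated _ (parent x) λ _ w≢p → cong indicator (selected-notToParent w≢p)) ⟩
      indicator (selected x (parent x)) + chosenChildren chosen x
        ≡⟨ cong (λ s → indicator s + chosenChildren chosen x) (selected-toParent x≢r) ⟩
      indicator (chosen x) + chosenChildren chosen x ∎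
      where open ≡-Reasoning

    subforest-parity : ∀ {x} → x ≢ root → parity (deg subforest x) ≡ target x
    subforest-parity {x} x≢r = begin
      parity (deg subforest x)                                ≡⟨ cong parity (deg-subforest x≢r) ⟩
      parity (indicator (chosen x) + chosenChildren chosen x) ≡⟨ ℙ.+-homo-+ (indicator (chosen x)) _ ⟩
      parity (indicator (chosen x)) ⊕ c                       ≡⟨ cong (_⊕ c) (chosen-parity x) ⟩
      (target x ⊕ c) ⊕ c                                      ≡⟨ ℙ.+-assoc (target x) c c ⟩
      target x ⊕ (c ⊕ c)                                      ≡⟨ cong (target x ⊕_) (ℙ.p+p≡0ℙ c) ⟩
      target x ⊕ 0ℙ                                           ≡⟨ ℙ.+-identityʳ (target x) ⟩
      target x                                                ∎
      where
      open ≡-Reasoning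
      c = parity (chosenChildren chosen x)

parityPrescribedForest : ∀ {n} (G : Graph n) → Connected G → ∀ root (target : Fin n → Parity) →
  ∃ λ F → F ⊆G G × IsForest F × (∀ {x} → x ≢ root → parity (deg F x) ≡ target x)
parityPrescribedForest G connected root target =
  subforest , (λ _ _ u~w → treeEdge⇒adj (subforest-treeEdge u~w)) ,
  treeEdges⇒forest subforest subforest-treeEdge , subforest-parity
  where
  open SpanningTree (BreadthFirst.spanningTree G root connected)
  open ParentPointers root parent depth parent-depth
  open ParitySubforest target
  treeEdge⇒adj : ∀ {u w} → TreeEdge u w → Adj G u w
  treeEdge⇒adj {u} {w} (inj₁ (w≢r , refl)) = trans (adj-sym G u w) (parent-adjacent w≢r)
  treeEdge⇒adj (inj₂ (u≢r , refl)) = parent-adjacent u≢r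

targetParity : ∀ {n} → Graph n → (Fin n → Bool) → Fin n → Parity
targetParity G side x = if side x then parity (deg G x) ⁻¹ else 0ℙ

corollary13 : ∀ {n} (G : Graph n) (side : Fin n → Bool) (v : Fin n)
    → Connected G
    → IsBipartition G side
    → side v ≡ true
    → (∀ x → side x ≡ false → Even (deg G x))
    → Σ (Graph n) λ F → F ⊆G G × IsForest F × Balanced F
        × (∀ x → deg F x ≡ 1 → side x ≡ true)
        × (∀ x → side x ≡ true → x ≢ v → ¬ Even (degOf (minusE G F) x))
corollary13 G side v connected bipartite v∈B _ with parityPrescribedForest G connected v (targetParity G side)
... | F , F⊆G , forest , F-parity = F , F⊆G , forest , balanced , leaves-in-B , B-odd
  where
  A-even : ∀ {x} → side x ≡ false → parity (deg F x) ≡ 0ℙ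
  A-even {x} x∈A = trans (F-parity λ { refl → contradiction (trans (sym x∈A) v∈B) λ () })
                         (cong (λ s → if s then _ else 0ℙ) x∈A)
  balanced : Balanced F
  balanced = side , (λ u w u~w → bipartite u w (F⊆G u w u~w)) , false ,
             λ x x∈A → parity≡0ℙ⇒even _ (A-even x∈A)
  leaves-in-B : ∀ x → deg F x ≡ 1 → side x ≡ true
  leaves-in-B x deg≡1 with side x in x-side
  ... | true = refl
  ... | false = contradiction (trans (cong parity (sym deg≡1)) (A-even x-side)) λ ()
  B-odd : ∀ x → side x ≡ true → x ≢ v → ¬ Even (degOf (minusE G F) x)
  B-odd x x∈B x≢v even = ℙ.p≢p⁻¹ (parity (deg G x)) (begin
    parity (deg G x)                                 ≡⟨ cong parity (degOf-minusE G F F⊆G x) ⟨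
    parity (degOf (minusE G F) x + deg F x)          ≡⟨ ℙ.+-homo-+ (degOf (minusE G F) x) (deg F x) ⟩
    parity (degOf (minusE G F) x) ⊕ parity (deg F x) ≡⟨ cong₂ _⊕_ (even⇒parity≡0ℙ even) (F-parity x≢v) ⟩
    targetParity G side x                            ≡⟨ cong (λ s → if s then _ else 0ℙ) x∈B ⟩
    parity (deg G x) ⁻¹                              ∎)
    where open ≡-Reasoning
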